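{- Let $[A,B,C]$ be an integral binary quadratic form with $B\equiv A+C\varepsilon\equiv0\pmod p$, let $M\in\Gamma^+_{ns}\setminus\Gamma_{ns}$ and $[A',B',C']=[A,B,C]\cdot M$. Then: (1) $A'\equiv -A\pmod p$; (2) $B'\equiv -B\pmod{2p}$; (3) $C'\equiv -C\pmod p$; (4) $A'-\varepsilon C'\equiv-(A-\varepsilon C)\pmod{p^2}$. In particular, for every integer $D$ and every $s\in\mathbb{Z}/2p^2$, $\mathcal{Q}_{ns,D,s}\cdot M=\mathcal{Q}_{ns,D,-s}$.
   Context: $p$ is an odd prime and $\varepsilon$ an integer that is not a square modulo $p$ with $\varepsilon\equiv1\pmod4$. $M_{ns}=\{\left(\begin{smallmatrix} a&b\\ c&d\end{smallmatrix}\right)\in M_2(\mathbb{Z}): a\equiv d,\ b\varepsilon\equiv c\pmod p\}$, $M_{ns}^+=M_{ns}\cup\{\left(\begin{smallmatrix} a&b\\ c&d\end{smallmatrix}\right)\in M_2(\mathbb{Z}): a\equiv -d,\ b\varepsilon\equiv -c\pmod p\}$, $\Gamma_{ns}=M_{ns}\cap\mathrm{SL}_2(\mathbb{Z})$, $\Gamma^+_{ns}=M^+_{ns}\cap\mathrm{SL}_2(\mathbb{Z})$. $[A,B,C]$ denotes $AX^2+BXY+CY^2$ and $[A,B,C]\cdot\left(\begin{smallmatrix}\alpha&\beta\\ \gamma&\delta\end{smallmatrix}\right)=[A\alpha^2+B\alpha\gamma+C\gamma^2,\ 2A\alpha\beta+B(\alpha\delta+\beta\gamma)+2C\gamma\delta,\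 A\beta^2+B\beta\delta+C\delta^2]$. For $s\in\mathbb{Z}/2p^2$, $\mathcal{Q}_{ns,D,s}=\{[A,B,C]: A,B,C\in\mathbb{Z},\ B^2-4AC=D,\ B\equiv A+C\varepsilon\equiv0\pmod p,\ A-C\varepsilon\equiv s\pmod{p^2},\ B\equiv s\pmod 2\}$. -}

module Defs where

open import Data.Nat using (ℕ)
open import Data.Nat.Primality using (Prime)
open import Data.Integer using (ℤ; +_; _+_; _-_; _*_; -_)
open import Data.Integer.Divisibility using (_∣_)
open import Data.Product using (Σ; ∃; _×_; _,_)
open import Relation.Binary.PropositionalEquality using (_≡_)
open import Relation.Nullary using (¬_)

Cong : ℕ → ℤ → ℤ → Set
Cong n a b = (+ n) ∣ (a - b)

NonSquareMod : ℕ → ℤ → Set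
NonSquareMod p ε = ¬ (∃ λ x → Cong p (x * x) ε)

-- 2x2 integer matrix ( a b ; c d )
record Mat : Set where
  constructor mat
  field
    a b c d : ℤ

det : Mat → ℤ
det (mat a b c d) = a * d - b * c

InMns : ℕ → ℤ → Mat → Set
InMns p ε (mat a b c d) = Cong p a d × Cong p (b * ε) c

InMnsMinus : ℕ → ℤ → Mat → Set
InMnsMinus p ε (mat a b c d) = Cong p a (- d) × Cong p (b * ε) (- c)

InΓns : ℕ → ℤ → Mat → Set
InΓns p ε M = InMns p ε M × det M ≡ + 1

data InMnsPlus (p : ℕ) (ε : ℤ) (M : Mat) : Set where
  inNs    : InMns p ε M → InMnsPlus p ε M
  inMinus : InMnsMinus p ε M → InMnsPlus p ε M

InΓnsPlus : ℕ → ℤ → Mat → Set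
InΓnsPlus p ε M = InMnsPlus p ε M × det M ≡ + 1

-- integral binary quadratic form [A,B,C] = A X^2 + B X Y + C Y^2
record QF : Set where
  constructor qf
  field
    A B C : ℤ

_·_ : QF → Mat → QF
qf A B C · mat α β γ δ =
  qf (A * α * α + B * α * γ + C * γ * γ)
     (+ 2 * A * α * β + B * (α * δ + β * γ) + + 2 * C * γ * δ)
     (A * β * β + B * β * δ + C * δ * δ)

disc : QF → ℤ
disc (qf A B C) = B * B - + 4 * A * C

-- membership in Q_{ns,D,s}; s ∈ Z/2p^2 is represented by an integer representative
-- (membership depends only on s mod 2p^2)
InQ : ℕ → ℤ → ℤ → ℤ → QF → Set
InQ p ε D s (qf A B C) =
  disc (qf A B C) ≡ D × Cong p B (+ 0) × Cong p (A + C * ε) (+ 0)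
  × Cong (p Data.Nat.* p) (A - C * ε) s × Cong 2 B s

module Submission where

-- M ∈ Γ_ns^+ \ Γ_ns lies in the "minus" piece of M_ns^+, so
-- for M = (a b ; c d) we may write d = up - a and c = vp - bε, and the
-- hypotheses on the form give B = mp and A = kp - Cε.  After these
-- substitutions each of the four differences  A' + A,  B' + B,  C' + C,
-- (A' - εC') + (A - εC)  is, as a polynomial identity, an explicit element
-- of  Nℤ + (det M - 1)ℤ  with N = p, 2p, p, p² respectively; since
-- det M = 1 this is statements (1)-(4).  For the "in particular": (1)-(4)
-- and the invariance of the discriminant under SL₂ move Q_{ns,D,s} into
-- Q_{ns,D,-s}; conversely the adjugate of M lies in the same minus piece
-- and undoes the action of M, which yields the required preimages.

open import Defs
open import Data.Nat using (ℕ)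
open import Data.Nat.Primality using (Prime)
open import Data.Integer using (ℤ; +_; _+_; _-_; _*_; -_)
open import Data.Product using (Σ; ∃; _×_; _,_)
open import Relation.Binary.PropositionalEquality using (_≡_)
open import Relation.Nullary using (¬_)
import Data.Nat as ℕ
import Data.Nat.Divisibility as ℕ
open import Data.Integer.Divisibility.Signed using (divides; ∣ᵤ⇒∣; ∣⇒∣ᵤ)
open import Data.Integer.Properties using (pos-*; neg-involutive; neg-distribˡ-*)
open import Data.Integer.Tactic.RingSolver using (solve-∀; solve)
open import Data.List using (_∷_; [])
open import Relation.Binary.PropositionalEquality using (refl; sym; trans; cong; cong₂; subst)
open import Data.Empty using (⊥-elim)

-- Cong n x y unfolds to a divisibility statement about x - y, from which
-- Agda cannot recover x and y; this wrapper keeps them visible, so that the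
-- congruence lemmas below can be chained with implicit arguments.
infix 4 _≡_mod_
record _≡_mod_ (x y : ℤ) (n : ℕ) : Set where
  constructor as-mod
  field divisibility : Cong n x y
open _≡_mod_ using (divisibility)

by-quotient : ∀ {n x y} (q : ℤ) → x - y ≡ q * + n → x ≡ y mod n
by-quotient q eq = as-mod (∣⇒∣ᵤ (divides q eq))

quotient : ∀ {n x y} → x ≡ y mod n → ∃ λ q → x - y ≡ q * + n
quotient (as-mod h) with ∣ᵤ⇒∣ h
... | divides q eq = q , eq

mod-trans : ∀ {n x y z} → x ≡ y mod n → y ≡ z mod n → x ≡ z mod n
mod-trans {n} {x} {y} {z} hxy hyz with quotient hxy | quotient hyz
... | q , eq | r , er =
  by-quotient (q + r) (trans (split x y z) (trans (cong₂ _+_ eq er) (distrib q r (+ n))))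
  where
  split : ∀ x y z → x - z ≡ (x - y) + (y - z)
  split = solve-∀
  distrib : ∀ q r n → q * n + r * n ≡ (q + r) * n
  distrib = solve-∀

mod-sym : ∀ {n x y} → x ≡ y mod n → y ≡ x mod n
mod-sym {n} {x} {y} h with quotient h
... | q , eq = by-quotient (- q) (trans (flip x y) (trans (cong -_ eq) (neg-distribˡ-* q (+ n))))
  where
  flip : ∀ x y → y - x ≡ - (x - y)
  flip = solve-∀

mod-neg : ∀ {n x y} → x ≡ y mod n → - x ≡ - y mod n
mod-neg {n} {x} {y} h with quotient h
... | q , eq = by-quotient (- q) (trans (negate x y) (trans (cong -_ eq) (neg-distribˡ-* q (+ n))))
  where
  negate : ∀ x y → - x - - y ≡ - (x - y)
  negate = solve-∀

mod-+ : ∀ {n x x′ y y′} → x ≡ y mod n → x′ ≡ y′ mod n → x + x′ ≡ y + y′ mod n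
mod-+ {n} {x} {x′} {y} {y′} h h′ with quotient h | quotient h′
... | q , eq | r , er =
  by-quotient (q + r) (trans (regroup x x′ y y′) (trans (cong₂ _+_ eq er) (distrib q r (+ n))))
  where
  regroup : ∀ x x′ y y′ → (x + x′) - (y + y′) ≡ (x - y) + (x′ - y′)
  regroup = solve-∀
  distrib : ∀ q r n → q * n + r * n ≡ (q + r) * n
  distrib = solve-∀

mod-*ʳ : ∀ {n x y} z → x ≡ y mod n → x * z ≡ y * z mod n
mod-*ʳ {n} {x} {y} z h with quotient h
... | q , eq = by-quotient (q * z) (trans (factor x y z) (trans (cong (_* z) {x - y} eq) (swap q (+ n) z)))
  where
  factor : ∀ x y z → x * z - y * z ≡ (x - y) * z
  factor = solve-∀
  swap : ∀ q n z → q * n * z ≡ q * z * n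
  swap = solve-∀

mod-respects : ∀ {n x x′ y y′} → x ≡ x′ → y ≡ y′ → x ≡ y mod n → x′ ≡ y′ mod n
mod-respects refl refl h = h

mod-divisor : ∀ {m n x y} → n ℕ.∣ m → x ≡ y mod m → x ≡ y mod n
mod-divisor n∣m (as-mod h) = as-mod (ℕ.∣-trans n∣m h)

minus-view : ∀ {p ε} M → InMnsMinus p ε M
  → (Mat.a M ≡ - Mat.d M mod p) × (Mat.b M * ε ≡ - Mat.c M mod p)
minus-view M (a≡-d , bε≡-c) = as-mod a≡-d , as-mod bε≡-c

Q-view : ∀ {p ε D s} F → InQ p ε D s F →
  disc F ≡ D × (QF.B F ≡ + 0 mod p) × (QF.A F + QF.C F * ε ≡ + 0 mod p)
  × (QF.A F - QF.C F * ε ≡ s mod p ℕ.* p) × (QF.B F ≡ s mod 2)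
Q-view F (disc≡D , B≡0 , A+Cε≡0 , A-Cε≡s , B≡s) =
  disc≡D , as-mod B≡0 , as-mod A+Cε≡0 , as-mod A-Cε≡s , as-mod B≡s

disc-· : ∀ F M → disc (F · M) ≡ det M * det M * disc F
disc-· (qf A B C) (mat a b c d) = expand A B C a b c d
  where
  expand : ∀ A B C a b c d →
    let A′ = A * a * a + B * a * c + C * c * c
        B′ = + 2 * A * a * b + B * (a * d + b * c) + + 2 * C * c * d
        C′ = A * b * b + B * b * d + C * d * d in
    B′ * B′ - + 4 * A′ * C′ ≡ (a * d - b * c) * (a * d - b * c) * (B * B - + 4 * A * C)
  expand = solve-∀

disc-SL₂ : ∀ F M → det M ≡ + 1 → disc (F · M) ≡ disc F
disc-SL₂ F M det≡1 = trans (disc-· F M) (trans (cong (λ δ → δ * δ * disc F) det≡1) (unit (disc F)))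
  where
  unit : ∀ x → + 1 * + 1 * x ≡ x
  unit = solve-∀

adj : Mat → Mat
adj (mat a b c d) = mat d (- b) (- c) a

det-adj : ∀ M → det (adj M) ≡ det M
det-adj (mat a b c d) = expand a b c d
  where
  expand : ∀ a b c d → d * a - (- b) * (- c) ≡ a * d - b * c
  expand = solve-∀

·-adj-· : ∀ F M → det M ≡ + 1 → (F · adj M) · M ≡ F
·-adj-· (qf A B C) (mat a b c d) det≡1 =
  cong₃ (trans (coeff₀ A B C a b c d) (scale-by-det A))
        (trans (coeff₁ A B C a b c d) (scale-by-det B))
        (trans (coeff₂ A B C a b c d) (scale-by-det C))
  where
  cong₃ : ∀ {A B C A′ B′ C′} → A ≡ A′ → B ≡ B′ → C ≡ C′ → qf A B C ≡ qf A′ B′ C′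
  cong₃ refl refl refl = refl
  unit : ∀ x → x * + 1 * + 1 ≡ x
  unit = solve-∀
  scale-by-det : ∀ x → x * det (mat a b c d) * det (mat a b c d) ≡ x
  scale-by-det x = trans (cong (λ δ → x * δ * δ) det≡1) (unit x)
  coeff₀ : ∀ A B C a b c d →
    let A₁ = A * d * d + B * d * (- c) + C * (- c) * (- c)
        B₁ = + 2 * A * d * (- b) + B * (d * a + (- b) * (- c)) + + 2 * C * (- c) * a
        C₁ = A * (- b) * (- b) + B * (- b) * a + C * a * a in
    A₁ * a * a + B₁ * a * c + C₁ * c * c ≡ A * (a * d - b * c) * (a * d - b * c)
  coeff₀ = solve-∀
  coeff₁ : ∀ A B C a b c d →
    let A₁ = A * d * d + B * d * (- c) + C * (- c) * (- c)
        B₁ = + 2 * A * d * (- b) + B * (d * a + (- b) * (- c)) + + 2 * C * (- c) * a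
        C₁ = A * (- b) * (- b) + B * (- b) * a + C * a * a in
    + 2 * A₁ * a * b + B₁ * (a * d + b * c) + + 2 * C₁ * c * d ≡ B * (a * d - b * c) * (a * d - b * c)
  coeff₁ = solve-∀
  coeff₂ : ∀ A B C a b c d →
    let A₁ = A * d * d + B * d * (- c) + C * (- c) * (- c)
        B₁ = + 2 * A * d * (- b) + B * (d * a + (- b) * (- c)) + + 2 * C * (- c) * a
        C₁ = A * (- b) * (- b) + B * (- b) * a + C * a * a in
    A₁ * b * b + B₁ * b * d + C₁ * d * d ≡ C * (a * d - b * c) * (a * d - b * c)
  coeff₂ = solve-∀

adj-minus : ∀ {p ε} M → InMnsMinus p ε M → InMnsMinus p ε (adj M)
adj-minus {ε = ε} (mat a b c d) minus with minus-view (mat a b c d) minus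
... | a≡-d , bε≡-c =
  divisibility (mod-sym (mod-respects refl (neg-involutive d) (mod-neg a≡-d))) ,
  divisibility (mod-respects (neg-distribˡ-* b ε) refl (mod-neg bε≡-c))

-- z lies in the ideal Nℤ + (δ - 1)ℤ; the core identities are of this form,
-- with δ the determinant of the acting matrix.
InDetIdeal : ℤ → ℤ → ℤ → Set
InDetIdeal N δ z = Σ ℤ λ W → Σ ℤ λ L → z ≡ W * N + L * (δ - + 1)

mod-via-det : ∀ {n x y δ} N → N ≡ + n → δ ≡ + 1 → InDetIdeal N δ (x - y) → x ≡ y mod n
mod-via-det N refl refl (W , L , eq) = by-quotient W (trans eq (drop W N L))
  where
  drop : ∀ W N L → W * N + L * (+ 1 - + 1) ≡ W * N
  drop = solve-∀

module _ (P k m C ε a b u v : ℤ) where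
  private
    vars = P ∷ k ∷ m ∷ C ∷ ε ∷ a ∷ b ∷ u ∷ v ∷ []

  identity-A : let A = k * P - C * ε ; B = m * P ; c = v * P - b * ε ; d = u * P - a in
    InDetIdeal P (a * d - b * c) ((A * a * a + B * a * c + C * c * c) - (- A))
  identity-A =
    k * (a * a + + 1) + m * a * (v * P - b * ε) + C * v * v * P - + 2 * C * v * b * ε - C * ε * (a * u - b * v) ,
    C * ε , solve vars

  identity-B : let A = k * P - C * ε ; B = m * P ; c = v * P - b * ε ; d = u * P - a in
    InDetIdeal (+ 2 * P) (a * d - b * c) ((+ 2 * A * a * b + B * (a * d + b * c) + + 2 * C * c * d) - (- B))
  identity-B =
    a * b * k + C * (u * v * P - a * v - b * ε * u) + m * (+ 1 + b * (v * P - b * ε)) ,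
    m * P , solve vars

  identity-C : let A = k * P - C * ε ; B = m * P ; c = v * P - b * ε ; d = u * P - a in
    InDetIdeal P (a * d - b * c) ((A * b * b + B * b * d + C * d * d) - (- C))
  identity-C =
    k * b * b + m * b * (u * P - a) + C * u * u * P - + 2 * C * u * a + C * (a * u - b * v) ,
    - C , solve vars

  identity-AεC : let A = k * P - C * ε ; B = m * P ; c = v * P - b * ε ; d = u * P - a in
    InDetIdeal (P * P) (a * d - b * c)
      (((A * a * a + B * a * c + C * c * c) - ε * (A * b * b + B * b * d + C * d * d)) - (- (A - ε * C)))
  identity-AεC =
    (a * u - b * v) * k + C * (v * v - ε * u * u) + m * (a * v - ε * b * u) ,
    - (k * P - C * ε - ε * C) , solve vars

Negates : ℕ → ℤ → QF → QF → Set
Negates p ε F G =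
  (QF.A G ≡ - QF.A F mod p)
  × (QF.B G ≡ - QF.B F mod 2 ℕ.* p)
  × (QF.C G ≡ - QF.C F mod p)
  × (QF.A G - ε * QF.C G ≡ - (QF.A F - ε * QF.C F) mod p ℕ.* p)

negates-parametrised : ∀ {p ε A B C a b c d} k m u v →
  A ≡ k * + p - C * ε → B ≡ m * + p → c ≡ v * + p - b * ε → d ≡ u * + p - a →
  det (mat a b c d) ≡ + 1 → Negates p ε (qf A B C) (qf A B C · mat a b c d)
negates-parametrised {p} {ε} {C = C} {a} {b} k m u v refl refl refl refl det≡1 =
  mod-via-det (+ p) refl det≡1 (identity-A (+ p) k m C ε a b u v) ,
  mod-via-det (+ 2 * + p) (sym (pos-* 2 p)) det≡1 (identity-B (+ p) k m C ε a b u v) ,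
  mod-via-det (+ p) refl det≡1 (identity-C (+ p) k m C ε a b u v) ,
  mod-via-det (+ p * + p) (sym (pos-* p p)) det≡1 (identity-AεC (+ p) k m C ε a b u v)

isolate-neg : ∀ x y {z} → x - - y ≡ z → y ≡ z - x
isolate-neg x y refl = solve (x ∷ y ∷ [])

isolate-zero : ∀ x {z} → x - + 0 ≡ z → x ≡ z
isolate-zero x refl = solve (x ∷ [])

isolate-sum : ∀ x y {z} → (x + y) - + 0 ≡ z → x ≡ z - y
isolate-sum x y refl = solve (x ∷ y ∷ [])

minus-negates : ∀ {p ε} F M → InMnsMinus p ε M → det M ≡ + 1
  → QF.B F ≡ + 0 mod p → QF.A F + QF.C F * ε ≡ + 0 mod p → Negates p ε F (F · M)
minus-negates {ε = ε} (qf A B C) (mat a b c d) minus det≡1 B≡0 A+Cε≡0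
  with minus-view (mat a b c d) minus
... | a≡-d , bε≡-c with quotient a≡-d | quotient bε≡-c | quotient B≡0 | quotient A+Cε≡0
... | u , eu | v , ev | m , em | k , ek =
  negates-parametrised k m u v (isolate-sum A (C * ε) ek) (isolate-zero B em)
    (isolate-neg (b * ε) c ev) (isolate-neg a d eu) det≡1

negates-InQ : ∀ {p ε D s} F G → Negates p ε F G → disc G ≡ disc F
  → InQ p ε D s F → InQ p ε D (- s) G
negates-InQ {p} {ε} (qf A B C) (qf A′ B′ C′) (A′≡-A , B′≡-B , C′≡-C , diff′≡-diff) disc≡ F∈Q
  with Q-view (qf A B C) F∈Q
... | discF≡D , B≡0 , A+Cε≡0 , A-Cε≡s , B≡s =
  trans disc≡ discF≡D ,
  divisibility (mod-trans (mod-divisor (ℕ.n∣m*n 2) B′≡-B) (mod-neg B≡0)) ,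
  divisibility (mod-trans (mod-respects refl (sum-neg A C ε) (mod-+ A′≡-A (mod-*ʳ ε C′≡-C)))
                          (mod-neg A+Cε≡0)) ,
  divisibility (mod-trans (mod-respects (commute A′ C′ ε) (cong -_ (commute A C ε)) diff′≡-diff)
                          (mod-neg A-Cε≡s)) ,
  divisibility (mod-trans (mod-divisor (ℕ.m∣m*n p) B′≡-B) (mod-neg B≡s))
  where
  sum-neg : ∀ A C ε → - A + - C * ε ≡ - (A + C * ε)
  sum-neg = solve-∀
  commute : ∀ A C ε → A - ε * C ≡ A - C * ε
  commute = solve-∀

minus-maps-Q : ∀ {p ε D s} M → InMnsMinus p ε M → det M ≡ + 1
  → (F : QF) → InQ p ε D s F → InQ p ε D (- s) (F · M)
minus-maps-Q M minus det≡1 F F∈Q with Q-view F F∈Q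
... | _ , B≡0 , A+Cε≡0 , _ =
  negates-InQ F (F · M) (minus-negates F M minus det≡1 B≡0 A+Cε≡0)
    (disc-SL₂ F M det≡1) F∈Q

minus-onto-Q : ∀ {p ε D s} M → InMnsMinus p ε M → det M ≡ + 1
  → (G : QF) → InQ p ε D (- s) G → Σ QF λ F → InQ p ε D s F × F · M ≡ G
minus-onto-Q {p} {ε} {D} {s} M minus det≡1 G G∈Q =
  G · adj M ,
  subst (λ t → InQ p ε D t (G · adj M)) (neg-involutive s)
    (minus-maps-Q (adj M) (adj-minus M minus) (trans (det-adj M) det≡1) G G∈Q) ,
  ·-adj-· G M det≡1

lemma5p3 : (p : ℕ) → Prime p → ¬ (p ≡ 2) → (ε : ℤ) → NonSquareMod p ε → Cong 4 ε (+ 1)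
    → (M : Mat) → InΓnsPlus p ε M → ¬ InΓns p ε M
    → ((F : QF) → Cong p (QF.B F) (+ 0) → Cong p (QF.A F + QF.C F * ε) (+ 0)
    → Cong p (QF.A (F · M)) (- QF.A F)
    × Cong (2 Data.Nat.* p) (QF.B (F · M)) (- QF.B F)
    × Cong p (QF.C (F · M)) (- QF.C F)
    × Cong (p Data.Nat.* p) (QF.A (F · M) - ε * QF.C (F · M)) (- (QF.A F - ε * QF.C F)))
    × ((D s : ℤ)
    → ((F : QF) → InQ p ε D s F → InQ p ε D (- s) (F · M))
    × ((G : QF) → InQ p ε D (- s) G → Σ QF λ F → InQ p ε D s F × F · M ≡ G))
-- M ∉ Γ_ns, so M lies in the minus piece of M_ns^+.
lemma5p3 p _ _ ε _ _ M (inNs ns , det≡1) M∉Γns = ⊥-elim (M∉Γns (ns , det≡1))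
lemma5p3 p _ _ ε _ _ M (inMinus minus , det≡1) _ =
  (λ F B≡0 A+Cε≡0 → forget (minus-negates F M minus det≡1 (as-mod B≡0) (as-mod A+Cε≡0))) ,
  λ D s → minus-maps-Q M minus det≡1 , minus-onto-Q M minus det≡1
  where
  forget : ∀ {n₁ n₂ n₃ n₄ x₁ x₂ x₃ x₄ y₁ y₂ y₃ y₄} →
    (x₁ ≡ y₁ mod n₁) × (x₂ ≡ y₂ mod n₂) × (x₃ ≡ y₃ mod n₃) × (x₄ ≡ y₄ mod n₄) →
    Cong n₁ x₁ y₁ × Cong n₂ x₂ y₂ × Cong n₃ x₃ y₃ × Cong n₄ x₄ y₄
  forget (h₁ , h₂ , h₃ , h₄) = divisibility h₁ , divisibility h₂ , divisibility h₃ , divisibility h₄
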